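{- For every integer $n\geq 4$, the path $P_4$ divides the hypercube $Q_n$.
   Context: $Q_n$ is the $n$-dimensional hypercube: its vertex set is the set of subsets of $\{1,2,\ldots,n\}$ (equivalently binary strings of length $n$), and two vertices $x,y$ are adjacent iff $|x\,\Delta\, y|=1$. $P_k$ denotes the path with $k$ edges. If $H$ is isomorphic to a subgraph of $G$, we say $H$ divides $G$ if there exist embeddings $\theta_1,\ldots,\theta_m$ of $H$ into $G$ such that $\{E(\theta_1(H)),\ldots,E(\theta_m(H))\}$ is a partition of $E(G)$. -}

module Defs where

open import Data.Nat using (ℕ)
open import Data.Bool using (Bool; not)
open import Data.Fin using (Fin; zero; suc; inject₁)
open import Data.Vec using (Vec; _[_]%=_)
open import Data.Product using (Σ; _×_; ∃)
open import Data.Sum using (_⊎_)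
open import Relation.Binary.PropositionalEquality using (_≡_)

-- Vertices of Q_n: binary strings of length n (characteristic vectors of subsets of {1..n}).
Vertex : ℕ → Set
Vertex n = Vec Bool n

Adj : ∀ {n} → Vertex n → Vertex n → Set
Adj {n} x y = Σ (Fin n) (λ k → y ≡ (x [ k ]%= not))

-- The path P_k with k edges has vertices 0..k and edges {i, i+1}.
-- An embedding of P_k into Q_n: an injective vertex map sending edges to edges.
record PathEmbedding (k n : ℕ) : Set where
  field
    vert      : Fin (Data.Nat.suc k) → Vertex n
    injective : ∀ i j → vert i ≡ vert j → i ≡ j
    edges-ok  : ∀ (i : Fin k) → Adj (vert (inject₁ i)) (vert (suc i))
open PathEmbedding public

IsPathEdge : ∀ {k n} → PathEmbedding k n → Fin k → Vertex n → Vertex n → Set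
IsPathEdge θ i u v =
  (u ≡ vert θ (inject₁ i) × v ≡ vert θ (suc i)) ⊎ (u ≡ vert θ (suc i) × v ≡ vert θ (inject₁ i))

-- H = P_k divides Q_n: there are embeddings θ_1..θ_m whose edge sets partition E(Q_n):
-- every edge of Q_n is an edge of exactly one θ_j (and is hit by exactly one path edge of it,
-- which is automatic by injectivity); edges of each θ_j are edges of Q_n by edges-ok.
PathDivides : ℕ → ℕ → Set
PathDivides k n =
  Σ ℕ λ m → Σ (Fin m → PathEmbedding k n) λ θ →
    (∀ u v → Adj u v →
       Σ (Fin m) (λ j → Σ (Fin k) (λ i → IsPathEdge (θ j) i u v))
       × (∀ j j' i i' → IsPathEdge (θ j) i u v → IsPathEdge (θ j') i' u v → j ≡ j'))

module Submission where

open import Defs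
open import Data.Bool using (Bool; true; false; not)
open import Data.Bool.Properties using (not-involutive; not-¬) renaming (_≟_ to _≟ᵇ_)
open import Data.Empty using (⊥; ⊥-elim)
open import Data.Fin as Fin using (Fin; zero; suc; inject₁; _↑ˡ_; _↑ʳ_; #_)
open import Data.Fin.Properties
  using (all?; any?; suc-injective; +↔⊎; *↔×; 2↔Bool; splitAt⁻¹-↑ˡ; splitAt⁻¹-↑ʳ)
  renaming (_≟_ to _≟ᶠ_)
open import Data.List as List using ()
open import Data.Maybe using (Maybe; just; nothing)
open import Data.Maybe.Properties using (just-injective) renaming (≡-dec to ≡-dec-maybe)
open import Data.Nat using (ℕ; zero; suc; _+_; _*_; _^_; _%_; _/_; _≡ᵇ_; _≤_; _<?_; s≤s)
open import Data.Product using (Σ; _×_; _,_; proj₁; proj₂)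
open import Data.Product.Function.NonDependent.Propositional using (_×-↔_)
open import Data.Sum using (_⊎_; inj₁; inj₂)
open import Data.Sum.Function.Propositional using (_⊎-↔_)
open import Data.Vec as Vec using (Vec; []; _∷_; _++_; _[_]%=_; _[_]≔_; lookup)
open import Data.Vec.Properties
  using ([]%=-∘; updateAt-id-local; ++-injectiveˡ; ++-injectiveʳ; ∷-injectiveˡ; ∷-injectiveʳ; ≡-dec)
open import Function using (_∘_)
open import Function.Bundles using (_↔_; Inverse; mk↔ₛ′)
open import Function.Properties.Inverse using (↔-refl; ↔-trans)
open import Relation.Binary.PropositionalEquality
open import Relation.Nullary using (Dec; no; _×-dec_; _⊎-dec_; _→-dec_)
open import Relation.Nullary.Decidable using (True; toWitness; map′)

-- The argument is by induction on n in steps of four, driven by a product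
-- construction.  Q_(a+b) is the Cartesian product Q_a □ Q_b: its vertices are
-- concatenations x ++ y, and each edge changes either the x-block or the
-- y-block.  Hence if P_k divides both Q_a and Q_b, then P_k divides Q_(a+b):
-- take a copy of a decomposition of Q_a in every layer Q_a × {y} and a copy
-- of a decomposition of Q_b in every layer {x} × Q_b.  The base cases Q₄, Q₅,
-- Q₆, Q₇ are explicit lists of 8, 20, 48 and 112 walks, verified by
-- computation to be simple paths covering every edge exactly once.  Every
-- n ≥ 4 is reached from one of them by adding copies of Q₄.

flip-involutive : ∀ {n} (x : Vertex n) k → (x [ k ]%= not) [ k ]%= not ≡ x
flip-involutive x k = trans ([]%=-∘ x k) (updateAt-id-local k x (not-involutive _))

flip-back : ∀ {n} {x y : Vertex n} {k} → y ≡ x [ k ]%= not → x ≡ y [ k ]%= not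
flip-back {x = x} {k = k} refl = sym (flip-involutive x k)

flip-injective : ∀ {n} (x : Vertex n) k l → x [ k ]%= not ≡ x [ l ]%= not → k ≡ l
flip-injective (b ∷ x) zero    zero    _  = refl
flip-injective (b ∷ x) zero    (suc l) eq = ⊥-elim (not-¬ refl (sym (∷-injectiveˡ eq)))
flip-injective (b ∷ x) (suc k) zero    eq = ⊥-elim (not-¬ refl (∷-injectiveˡ eq))
flip-injective (b ∷ x) (suc k) (suc l) eq = cong suc (flip-injective x k l (∷-injectiveʳ eq))

flip-++ˡ : ∀ {a b} (x : Vertex a) (y : Vertex b) k →
  (x ++ y) [ k ↑ˡ b ]%= not ≡ (x [ k ]%= not) ++ y
flip-++ˡ (c ∷ x) y zero    = refl
flip-++ˡ (c ∷ x) y (suc k) = cong (c ∷_) (flip-++ˡ x y k)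

flip-++ʳ : ∀ {a b} (x : Vertex a) (y : Vertex b) k →
  (x ++ y) [ a ↑ʳ k ]%= not ≡ x ++ (y [ k ]%= not)
flip-++ʳ []      y k = refl
flip-++ʳ (c ∷ x) y k = cong (c ∷_) (flip-++ʳ x y k)

split-edge : ∀ {a b} (x : Vertex a) (y : Vertex b) (k : Fin (a + b)) →
  (Σ (Fin a) λ k′ → (x ++ y) [ k ]%= not ≡ (x [ k′ ]%= not) ++ y) ⊎
  (Σ (Fin b) λ k′ → (x ++ y) [ k ]%= not ≡ x ++ (y [ k′ ]%= not))
split-edge {a} {b} x y k with Fin.splitAt a k in eq
... | inj₁ k′ = inj₁ (k′ , trans (cong (λ l → (x ++ y) [ l ]%= not) (sym (splitAt⁻¹-↑ˡ eq)))
                                 (flip-++ˡ x y k′))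
... | inj₂ k′ = inj₂ (k′ , trans (cong (λ l → (x ++ y) [ l ]%= not) (sym (splitAt⁻¹-↑ʳ eq)))
                                 (flip-++ʳ x y k′))

path-edge-distinct : ∀ {k n} (θ : PathEmbedding k n) i {u v} →
  IsPathEdge θ i u v → u ≡ v → ⊥
path-edge-distinct θ i (inj₁ (refl , refl)) u≡v = inject₁≢suc i (injective θ _ _ u≡v)
  where
  inject₁≢suc : ∀ {k} (i : Fin k) → inject₁ i ≡ suc i → ⊥
  inject₁≢suc zero    ()
  inject₁≢suc (suc i) eq = inject₁≢suc i (suc-injective eq)
path-edge-distinct θ i (inj₂ (refl , refl)) u≡v = path-edge-distinct θ i (inj₁ (refl , refl)) (sym u≡v)

path-edge-adjacent : ∀ {k n} (θ : PathEmbedding k n) i {u v} → IsPathEdge θ i u v → Adj u v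
path-edge-adjacent θ i (inj₁ (refl , refl)) = edges-ok θ i
path-edge-adjacent θ i (inj₂ (refl , refl)) =
  let (k , e) = edges-ok θ i in k , flip-back e

_≟ᵛ_ : ∀ {n} (x y : Vertex n) → Dec (x ≡ y)
_≟ᵛ_ = ≡-dec _≟ᵇ_

isPathEdge? : ∀ {k n} (θ : PathEmbedding k n) i u v → Dec (IsPathEdge θ i u v)
isPathEdge? θ i u v =
  (u ≟ᵛ vert θ (inject₁ i) ×-dec v ≟ᵛ vert θ (suc i)) ⊎-dec
  (u ≟ᵛ vert θ (suc i) ×-dec v ≟ᵛ vert θ (inject₁ i))

record Decomposition (k n : ℕ) : Set₁ where
  field
    Index  : Set
    count  : ℕ
    finite : Fin count ↔ Index
    path   : Index → PathEmbedding k n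
    covers : ∀ u v → Adj u v → Σ Index λ j → Σ (Fin k) λ i → IsPathEdge (path j) i u v
    unique : ∀ {u v} j j′ i i′ →
      IsPathEdge (path j) i u v → IsPathEdge (path j′) i′ u v → j ≡ j′

toPathDivides : ∀ {k n} → Decomposition k n → PathDivides k n
toPathDivides D = count , path ∘ to , λ u v uv →
  let (j , i , e) = covers u v uv in
  (from j , i , subst (λ j′ → IsPathEdge (path j′) i u v) (sym (strictlyInverseˡ j)) e) ,
  λ j j′ i i′ e e′ → begin
    j             ≡⟨ strictlyInverseʳ j ⟨
    from (to j)   ≡⟨ cong from (unique (to j) (to j′) i i′ e e′) ⟩
    from (to j′)  ≡⟨ strictlyInverseʳ j′ ⟩
    j′            ∎
  where
  open Decomposition D
  open Inverse finite
  open ≡-Reasoning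

-- The vertices of Q_n are enumerated by Fin (2 ^ n), first coordinate most
-- significant; this makes the index set of a product decomposition finite.
vertices : ∀ n → Fin (2 ^ n) ↔ Vertex n
vertices zero    = mk↔ₛ′ (λ _ → []) (λ _ → zero) (λ { [] → refl }) (λ { zero → refl })
vertices (suc n) = ↔-trans *↔× (↔-trans (2↔Bool ×-↔ vertices n) cons↔)
  where
  cons↔ : (Bool × Vertex n) ↔ Vertex (suc n)
  cons↔ = mk↔ₛ′ (λ p → proj₁ p ∷ proj₂ p) (λ { (b ∷ x) → b , x }) (λ { (b ∷ x) → refl }) (λ _ → refl)

record CubeEmbedding (a c : ℕ) : Set where
  field
    map           : Vertex a → Vertex c
    map-injective : ∀ {x y} → map x ≡ map y → x ≡ y
    map-adjacent  : ∀ {x y} → Adj x y → Adj (map x) (map y)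

transport : ∀ {k a c} → CubeEmbedding a c → PathEmbedding k a → PathEmbedding k c
transport φ θ = record
  { vert      = map ∘ vert θ
  ; injective = λ i j eq → injective θ i j (map-injective eq)
  ; edges-ok  = λ i → map-adjacent (edges-ok θ i)
  }
  where open CubeEmbedding φ

transport-edge : ∀ {k a c} (φ : CubeEmbedding a c) θ (i : Fin k) {x x′} →
  IsPathEdge θ i x x′ → IsPathEdge (transport φ θ) i (CubeEmbedding.map φ x) (CubeEmbedding.map φ x′)
transport-edge φ θ i (inj₁ (refl , refl)) = inj₁ (refl , refl)
transport-edge φ θ i (inj₂ (refl , refl)) = inj₂ (refl , refl)

record EdgePreimage {k a c} (φ : CubeEmbedding a c) (θ : PathEmbedding k a) (i : Fin k)
                    (u v : Vertex c) : Set where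
  field
    {x x′}   : Vertex a
    u≡       : u ≡ CubeEmbedding.map φ x
    v≡       : v ≡ CubeEmbedding.map φ x′
    original : IsPathEdge θ i x x′

transport-edge⁻¹ : ∀ {k a c} (φ : CubeEmbedding a c) θ (i : Fin k) {u v} →
  IsPathEdge (transport φ θ) i u v → EdgePreimage φ θ i u v
transport-edge⁻¹ φ θ i (inj₁ (refl , refl)) = record { u≡ = refl ; v≡ = refl ; original = inj₁ (refl , refl) }
transport-edge⁻¹ φ θ i (inj₂ (refl , refl)) = record { u≡ = refl ; v≡ = refl ; original = inj₂ (refl , refl) }

append : ∀ {a b} → Vertex b → CubeEmbedding a (a + b)
append {b = b} y = record
  { map           = _++ y
  ; map-injective = ++-injectiveˡ _ _
  ; map-adjacent  = λ { {x} (k , refl) → k ↑ˡ b , sym (flip-++ˡ x y k) }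
  }

prepend : ∀ {a b} → Vertex a → CubeEmbedding b (a + b)
prepend {a} x = record
  { map           = x ++_
  ; map-injective = ++-injectiveʳ x x
  ; map-adjacent  = λ { {y} (k , refl) → a ↑ʳ k , sym (flip-++ʳ x y k) }
  }

product : ∀ {k a b} → Decomposition k a → Decomposition k b → Decomposition k (a + b)
product {k} {a} {b} D E = record
  { Index  = (D.Index × Vertex b) ⊎ (E.Index × Vertex a)
  ; count  = D.count * 2 ^ b + E.count * 2 ^ a
  ; finite = ↔-trans +↔⊎ (↔-trans *↔× (D.finite ×-↔ vertices b) ⊎-↔
                          ↔-trans *↔× (E.finite ×-↔ vertices a))
  ; path   = path
  ; covers = covers
  ; unique = unique
  }
  where
  module D = Decomposition D
  module E = Decomposition E

  path : (D.Index × Vertex b) ⊎ (E.Index × Vertex a) → PathEmbedding k (a + b)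
  path (inj₁ (j , y)) = transport (append y) (D.path j)
  path (inj₂ (j , x)) = transport (prepend x) (E.path j)

  covers : ∀ u v → Adj u v → Σ _ λ j → Σ (Fin k) λ i → IsPathEdge (path j) i u v
  covers u v (l , refl) with Vec.splitAt a u
  ... | x , y , refl with split-edge x y l
  ...   | inj₁ (l′ , eq) =
          let (j , i , e) = D.covers x (x [ l′ ]%= not) (l′ , refl) in
          inj₁ (j , y) , i , subst (IsPathEdge (path (inj₁ (j , y))) i (x ++ y)) (sym eq)
                                   (transport-edge (append y) (D.path j) i e)
  ...   | inj₂ (l′ , eq) =
          let (j , i , e) = E.covers y (y [ l′ ]%= not) (l′ , refl) in
          inj₂ (j , x) , i , subst (IsPathEdge (path (inj₂ (j , x))) i (x ++ y)) (sym eq)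
                                   (transport-edge (prepend x) (E.path j) i e)

  -- Within one family of layers, equal edges come from the same layer and the
  -- same edge there; across the families an edge would have to change
  -- neither block, contradicting that its endpoints are distinct.
  unique : ∀ {u v} j j′ i i′ → IsPathEdge (path j) i u v → IsPathEdge (path j′) i′ u v → j ≡ j′
  unique (inj₁ (j , y)) (inj₁ (j′ , y′)) i i′ e e′
    with transport-edge⁻¹ (append y) (D.path j) i e | transport-edge⁻¹ (append y′) (D.path j′) i′ e′
  ... | record { x = x₁ ; x′ = x₁′ ; u≡ = refl ; v≡ = refl ; original = o }
      | record { x = x₂ ; x′ = x₂′ ; u≡ = u≡ ; v≡ = v≡ ; original = o′ }
    with ++-injectiveˡ x₁ x₂ u≡ | ++-injectiveʳ x₁ x₂ u≡ | ++-injectiveˡ x₁′ x₂′ v≡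
  ... | refl | refl | refl = cong (λ j → inj₁ (j , y)) (D.unique j j′ i i′ o o′)
  unique (inj₂ (j , x)) (inj₂ (j′ , x′)) i i′ e e′
    with transport-edge⁻¹ (prepend x) (E.path j) i e | transport-edge⁻¹ (prepend x′) (E.path j′) i′ e′
  ... | record { u≡ = refl ; v≡ = refl ; original = o } | record { u≡ = u≡ ; v≡ = v≡ ; original = o′ }
    with ++-injectiveˡ x x′ u≡ | ++-injectiveʳ x x′ u≡ | ++-injectiveʳ x x′ v≡
  ... | refl | refl | refl = cong (λ j → inj₂ (j , x)) (E.unique j j′ i i′ o o′)
  unique (inj₁ (j , y)) (inj₂ (j′ , x)) i i′ e e′
    with transport-edge⁻¹ (append y) (D.path j) i e | transport-edge⁻¹ (prepend x) (E.path j′) i′ e′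
  ... | record { x = x₁ ; x′ = x₁′ ; u≡ = refl ; v≡ = refl ; original = o } | record { u≡ = u≡ ; v≡ = v≡ } =
    ⊥-elim (path-edge-distinct (D.path j) i o (trans (++-injectiveˡ x₁ x u≡) (sym (++-injectiveˡ x₁′ x v≡))))
  unique (inj₂ (j , x)) (inj₁ (j′ , y)) i i′ e e′
    with transport-edge⁻¹ (prepend x) (E.path j) i e | transport-edge⁻¹ (append y) (D.path j′) i′ e′
  ... | record { u≡ = refl ; v≡ = refl ; original = o } | record { x = x₂ ; x′ = x₂′ ; u≡ = u≡ ; v≡ = v≡ } =
    ⊥-elim (path-edge-distinct (E.path j) i o (trans (++-injectiveʳ x x₂ u≡) (sym (++-injectiveʳ x x₂′ v≡))))

-- A walk in Q_n with k steps: a start vertex and the coordinate flipped at each step.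
record Walk (k n : ℕ) : Set where
  constructor walk
  field
    start : Vertex n
    steps : Vec (Fin n) k
open Walk

visit : ∀ {k n} → Walk k n → Fin (suc k) → Vertex n
visit (walk x ds)       zero    = x
visit (walk x (d ∷ ds)) (suc i) = visit (walk (x [ d ]%= not) ds) i

visit-step : ∀ {k n} (w : Walk k n) (i : Fin k) →
  visit w (suc i) ≡ visit w (inject₁ i) [ lookup (steps w) i ]%= not
visit-step (walk x (d ∷ ds)) zero    = refl
visit-step (walk x (d ∷ ds)) (suc i) = visit-step (walk (x [ d ]%= not) ds) i

Simple : ∀ {k n} → Walk k n → Set
Simple {k} w = ∀ (i j : Fin (suc k)) → visit w i ≡ visit w j → i ≡ j

simple? : ∀ {k n} (w : Walk k n) → Dec (Simple w)
simple? w = all? λ i → all? λ j → (visit w i ≟ᵛ visit w j) →-dec (i ≟ᶠ j)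

walkPath : ∀ {k n} (w : Walk k n) → Simple w → PathEmbedding k n
walkPath w simple = record
  { vert      = visit w
  ; injective = simple
  ; edges-ok  = λ i → lookup (steps w) i , visit-step w i
  }

all-vertices? : ∀ {n} {P : Vertex n → Set} → (∀ u → Dec (P u)) → Dec (∀ u → P u)
all-vertices? {zero}  P? = map′ (λ { p [] → p }) (λ p → p []) (P? [])
all-vertices? {suc n} P? =
  map′ (λ { (p , q) (false ∷ u) → p u ; (p , q) (true ∷ u) → q u })
       (λ p → (p ∘ (false ∷_)) , (p ∘ (true ∷_)))
       (all-vertices? (P? ∘ (false ∷_)) ×-dec all-vertices? (P? ∘ (true ∷_)))

VertexMap : ℕ → Set → Set
VertexMap zero    A = A
VertexMap (suc n) A = VertexMap n A × VertexMap n A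

constant : ∀ n {A : Set} → A → VertexMap n A
constant zero    a = a
constant (suc n) a = constant n a , constant n a

_!_ : ∀ {n A} → VertexMap n A → Vertex n → A
_!_ {zero}  t         []          = t
_!_ {suc n} (t₀ , t₁) (false ∷ u) = t₀ ! u
_!_ {suc n} (t₀ , t₁) (true ∷ u)  = t₁ ! u

adjust : ∀ {n A} → Vertex n → (A → A) → VertexMap n A → VertexMap n A
adjust {zero}  []          f t         = f t
adjust {suc n} (false ∷ u) f (t₀ , t₁) = adjust u f t₀ , t₁
adjust {suc n} (true ∷ u)  f (t₀ , t₁) = t₀ , adjust u f t₁

-- An owner table records, for each vertex u and direction l, which walk (if
-- any) is claimed to contain the edge {u , u with l flipped}.
OwnerTable : ℕ → ℕ → Set
OwnerTable n m = VertexMap n (Vec (Maybe (Fin m)) n)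

ownerTable : ∀ {k n m} → Vec (Walk k n) m → OwnerTable n m
ownerTable {k} {n} {m} walks =
  List.foldr (λ j → claimWalk j (lookup walks j)) (constant n (Vec.replicate n nothing)) (List.allFin m)
  where
  claimWalk : Fin m → Walk k n → OwnerTable n m → OwnerTable n m
  claimWalk j w t = List.foldr claimEdge t (List.allFin k)
    where
    claimEdge : Fin k → OwnerTable n m → OwnerTable n m
    claimEdge i = mark (visit w (inject₁ i)) ∘ mark (visit w (suc i))
      where
      mark : Vertex n → OwnerTable n m → OwnerTable n m
      mark u = adjust u (_[ lookup (steps w) i ]≔ just j)

-- A list of m simple walks is a decomposition as soon as, for some owner
-- table, two finite checks succeed: every edge is contained in the walk the
-- table names for it (Covering), and every edge of every walk is named by the
-- table for that walk (Disjoint).  Two walks sharing an edge are then both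
-- the named owner of that edge, hence equal.  The table is only a hint: its
-- correctness is never assumed, only checked.
module Certificate {k n m : ℕ} (walks : Vec (Walk k n) m)
                   (simple : ∀ j → Simple (lookup walks j)) (table : OwnerTable n m) where

  path : Fin m → PathEmbedding k n
  path j = walkPath (lookup walks j) (simple j)

  owner : Vertex n → Fin n → Maybe (Fin m)
  owner u l = lookup (table ! u) l

  OwnedBy : Maybe (Fin m) → Vertex n → Vertex n → Set
  OwnedBy (just j) u v = Σ (Fin k) λ i → IsPathEdge (path j) i u v
  OwnedBy nothing  u v = ⊥

  ownedBy? : ∀ o u v → Dec (OwnedBy o u v)
  ownedBy? (just j) u v = any? λ i → isPathEdge? (path j) i u v
  ownedBy? nothing  u v = no λ ()

  Covering : Set
  Covering = ∀ u l → OwnedBy (owner u l) u (u [ l ]%= not)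

  covering? : Dec Covering
  covering? = all-vertices? λ u → all? λ l → ownedBy? (owner u l) u (u [ l ]%= not)

  Disjoint : Set
  Disjoint = ∀ j i → let w = lookup walks j ; d = lookup (steps w) i in
    owner (visit w (inject₁ i)) d ≡ just j × owner (visit w (suc i)) d ≡ just j

  disjoint? : Dec Disjoint
  disjoint? = all? λ j → all? λ i → let w = lookup walks j ; d = lookup (steps w) i in
    owner (visit w (inject₁ i)) d ≟ᵒ just j ×-dec owner (visit w (suc i)) d ≟ᵒ just j
    where
    _≟ᵒ_ : (o o′ : Maybe (Fin m)) → Dec (o ≡ o′)
    _≟ᵒ_ = ≡-dec-maybe _≟ᶠ_

  owner-unique : Disjoint → ∀ {u} l j i → IsPathEdge (path j) i u (u [ l ]%= not) → owner u l ≡ just j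
  owner-unique disjoint l j i (inj₁ (refl , e))
    rewrite flip-injective _ l _ (trans e (visit-step (lookup walks j) i)) = proj₁ (disjoint j i)
  owner-unique disjoint l j i (inj₂ (refl , e))
    rewrite flip-injective _ l _ (trans e (flip-back (visit-step (lookup walks j) i))) = proj₂ (disjoint j i)

  decomposition : Covering → Disjoint → Decomposition k n
  decomposition covering disjoint = record
    { Index  = Fin m
    ; count  = m
    ; finite = ↔-refl
    ; path   = path
    ; covers = covers
    ; unique = unique
    }
    where
    covers : ∀ u v → Adj u v → Σ (Fin m) λ j → Σ (Fin k) λ i → IsPathEdge (path j) i u v
    covers u _ (l , refl) with owner u l | covering u l
    ... | just j | owned = j , owned

    unique : ∀ {u v} j j′ i i′ → IsPathEdge (path j) i u v → IsPathEdge (path j′) i′ u v → j ≡ j′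
    unique j j′ i i′ e e′ with path-edge-adjacent (path j) i e
    ... | l , refl = just-injective (trans (sym (owner-unique disjoint l j i e)) (owner-unique disjoint l j′ i′ e′))

-- Taking the
-- table as an argument lets it be computed once and shared by all checks.
certified : ∀ {k n m} (walks : Vec (Walk k n) m) (table : OwnerTable n m)
  {simple : True (all? λ j → simple? (lookup walks j))} →
  let open Certificate walks (toWitness simple) table in
  {covering : True covering?} {disjoint : True disjoint?} → Decomposition k n
certified walks table {simple} {covering} {disjoint} =
  decomposition (toWitness covering) (toWitness disjoint)
  where open Certificate walks (toWitness simple) table

-- The vertex whose coordinates are the binary digits of s, least significant first.
binary : ∀ n → ℕ → Vertex n
binary zero    s = []
binary (suc n) s = (s % 2 ≡ᵇ 1) ∷ binary n (s / 2)

walk₄ : ∀ {n} (s a b c d : ℕ)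
  {a< : True (a <? n)} {b< : True (b <? n)} {c< : True (c <? n)} {d< : True (d <? n)} → Walk 4 n
walk₄ {n} s a b c d {a<} {b<} {c<} {d<} =
  walk (binary n s) ((# a) {m<n = a<} ∷ (# b) {m<n = b<} ∷ (# c) {m<n = c<} ∷ (# d) {m<n = d<} ∷ [])

-- Base cases: explicit decompositions of Q₄, Q₅, Q₆ and Q₇, found by computer search.
D₄ : Decomposition 4 4
D₄ = certified walks (ownerTable walks)
  where
  walks : Vec (Walk 4 4) 8
  walks =
    walk₄ 0 0 3 2 3 ∷ walk₄ 11 3 1 2 1 ∷ walk₄ 15 0 1 3 0 ∷ walk₄ 8 2 0 1 2 ∷
    walk₄ 0 1 2 0 3 ∷ walk₄ 8 1 3 0 2 ∷ walk₄ 0 2 1 3 2 ∷ walk₄ 0 3 0 1 0 ∷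
    []

D₅ : Decomposition 4 5
D₅ = certified walks (ownerTable walks)
  where
  walks : Vec (Walk 4 5) 20
  walks =
    walk₄ 2 1 0 2 3 ∷ walk₄ 0 2 4 1 3 ∷ walk₄ 30 4 1 3 0 ∷ walk₄ 4 1 0 2 0 ∷
    walk₄ 31 3 1 4 1 ∷ walk₄ 6 3 0 3 4 ∷ walk₄ 11 0 3 2 4 ∷ walk₄ 31 0 2 4 2 ∷
    walk₄ 22 0 2 3 0 ∷ walk₄ 2 4 1 0 3 ∷ walk₄ 1 4 1 0 2 ∷ walk₄ 31 2 4 3 4 ∷
    walk₄ 29 4 2 3 1 ∷ walk₄ 18 3 1 3 2 ∷ walk₄ 28 4 2 3 4 ∷ walk₄ 12 0 1 2 1 ∷
    walk₄ 15 4 1 0 2 ∷ walk₄ 17 2 0 3 1 ∷ walk₄ 21 3 2 4 0 ∷ walk₄ 27 1 0 4 1 ∷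
    []

D₆ : Decomposition 4 6
D₆ = certified walks (ownerTable walks)
  where
  walks : Vec (Walk 4 6) 48
  walks =
    walk₄ 2 1 0 4 2 ∷ walk₄ 13 3 0 2 4 ∷ walk₄ 0 3 1 2 5 ∷ walk₄ 0 5 4 0 1 ∷
    walk₄ 9 3 2 4 0 ∷ walk₄ 35 5 1 5 2 ∷ walk₄ 5 5 0 1 2 ∷ walk₄ 5 1 2 4 5 ∷
    walk₄ 18 3 4 3 0 ∷ walk₄ 3 3 2 1 0 ∷ walk₄ 56 1 4 5 0 ∷ walk₄ 30 3 2 4 5 ∷
    walk₄ 2 2 1 4 3 ∷ walk₄ 4 5 4 3 0 ∷ walk₄ 4 3 4 2 4 ∷ walk₄ 8 5 3 2 3 ∷
    walk₄ 9 0 2 5 4 ∷ walk₄ 12 1 4 5 3 ∷ walk₄ 23 0 4 3 0 ∷ walk₄ 20 1 5 0 2 ∷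
    walk₄ 25 3 0 2 5 ∷ walk₄ 21 1 4 0 5 ∷ walk₄ 17 1 0 5 3 ∷ walk₄ 54 1 2 5 1 ∷
    walk₄ 16 3 5 0 2 ∷ walk₄ 50 1 3 4 0 ∷ walk₄ 56 2 1 0 3 ∷ walk₄ 27 1 2 0 5 ∷
    walk₄ 28 1 0 2 3 ∷ walk₄ 63 2 0 5 2 ∷ walk₄ 58 2 4 0 1 ∷ walk₄ 24 1 0 4 1 ∷
    walk₄ 24 0 5 1 3 ∷ walk₄ 27 5 4 2 3 ∷ walk₄ 19 2 5 1 3 ∷ walk₄ 23 3 5 1 5 ∷
    walk₄ 29 1 4 5 4 ∷ walk₄ 51 4 2 5 3 ∷ walk₄ 33 0 1 4 0 ∷ walk₄ 50 2 4 0 4 ∷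
    walk₄ 52 0 5 3 4 ∷ walk₄ 9 2 5 3 1 ∷ walk₄ 37 4 2 3 4 ∷ walk₄ 17 5 4 3 2 ∷
    walk₄ 11 5 1 5 4 ∷ walk₄ 38 3 1 0 4 ∷ walk₄ 35 0 3 1 2 ∷ walk₄ 33 1 3 0 2 ∷
    []

D₇ : Decomposition 4 7
D₇ = certified walks (ownerTable walks)
  where
  walks : Vec (Walk 4 7) 112
  walks =
    walk₄ 8 3 0 5 1 ∷ walk₄ 0 5 3 4 2 ∷ walk₄ 0 4 5 2 6 ∷ walk₄ 67 1 0 6 2 ∷
    walk₄ 0 1 0 3 4 ∷ walk₄ 32 4 0 1 5 ∷ walk₄ 50 1 3 5 1 ∷ walk₄ 48 6 0 5 0 ∷
    walk₄ 56 0 4 0 5 ∷ walk₄ 59 0 1 6 5 ∷ walk₄ 108 2 6 1 6 ∷ walk₄ 40 2 5 3 5 ∷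
    walk₄ 36 1 2 1 0 ∷ walk₄ 116 2 4 6 2 ∷ walk₄ 126 3 2 1 3 ∷ walk₄ 94 3 1 2 5 ∷
    walk₄ 85 2 6 0 6 ∷ walk₄ 114 4 5 1 4 ∷ walk₄ 82 1 3 6 4 ∷ walk₄ 29 0 3 2 3 ∷
    walk₄ 16 1 5 6 0 ∷ walk₄ 24 2 6 1 4 ∷ walk₄ 24 0 1 3 1 ∷ walk₄ 83 0 5 3 1 ∷
    walk₄ 74 1 3 5 2 ∷ walk₄ 64 2 1 6 0 ∷ walk₄ 96 3 1 2 0 ∷ walk₄ 117 4 2 0 1 ∷
    walk₄ 99 3 1 0 4 ∷ walk₄ 76 4 2 4 5 ∷ walk₄ 88 1 2 6 4 ∷ walk₄ 88 0 5 3 1 ∷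
    walk₄ 120 0 2 4 0 ∷ walk₄ 120 2 4 5 6 ∷ walk₄ 93 1 0 5 0 ∷ walk₄ 89 4 6 0 6 ∷
    walk₄ 72 2 0 6 1 ∷ walk₄ 72 0 1 2 6 ∷ walk₄ 8 2 0 3 0 ∷ walk₄ 8 1 3 2 5 ∷
    walk₄ 14 1 4 1 2 ∷ walk₄ 28 5 3 0 4 ∷ walk₄ 38 6 1 5 3 ∷ walk₄ 76 1 0 1 2 ∷
    walk₄ 67 5 1 5 3 ∷ walk₄ 73 5 2 1 5 ∷ walk₄ 71 3 4 6 0 ∷ walk₄ 22 3 5 6 2 ∷
    walk₄ 53 3 6 0 1 ∷ walk₄ 36 3 1 6 4 ∷ walk₄ 41 3 6 3 4 ∷ walk₄ 97 4 2 5 4 ∷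
    walk₄ 39 1 2 4 6 ∷ walk₄ 34 0 3 1 6 ∷ walk₄ 9 5 2 6 5 ∷ walk₄ 118 1 4 0 3 ∷
    walk₄ 100 3 6 0 5 ∷ walk₄ 7 1 5 0 6 ∷ walk₄ 108 1 5 2 3 ∷ walk₄ 36 4 1 0 1 ∷
    walk₄ 44 4 1 4 5 ∷ walk₄ 25 2 3 0 5 ∷ walk₄ 7 6 0 5 3 ∷ walk₄ 63 1 0 6 5 ∷
    walk₄ 69 0 4 5 3 ∷ walk₄ 15 0 3 1 6 ∷ walk₄ 4 4 1 2 3 ∷ walk₄ 20 6 0 6 5 ∷
    walk₄ 84 3 0 2 1 ∷ walk₄ 116 0 1 5 3 ∷ walk₄ 6 4 6 4 2 ∷ walk₄ 70 3 6 2 5 ∷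
    walk₄ 61 2 3 2 6 ∷ walk₄ 117 3 1 2 4 ∷ walk₄ 71 1 3 4 5 ∷ walk₄ 19 4 1 4 5 ∷
    walk₄ 118 5 0 1 3 ∷ walk₄ 91 6 2 1 6 ∷ walk₄ 58 6 5 3 2 ∷ walk₄ 29 5 4 1 6 ∷
    walk₄ 99 2 1 6 3 ∷ walk₄ 65 6 2 6 5 ∷ walk₄ 25 6 3 4 2 ∷ walk₄ 15 2 1 2 4 ∷
    walk₄ 1 3 4 3 2 ∷ walk₄ 5 4 1 2 6 ∷ walk₄ 2 6 4 6 0 ∷ walk₄ 46 2 3 5 4 ∷
    walk₄ 25 5 1 2 3 ∷ walk₄ 57 6 1 6 3 ∷ walk₄ 66 0 6 2 4 ∷ walk₄ 3 5 6 4 5 ∷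
    walk₄ 111 3 0 2 0 ∷ walk₄ 102 4 0 2 6 ∷ walk₄ 115 3 5 0 6 ∷ walk₄ 43 6 0 4 0 ∷
    walk₄ 95 2 4 0 4 ∷ walk₄ 81 1 4 2 4 ∷ walk₄ 55 5 6 2 3 ∷ walk₄ 67 3 5 2 4 ∷
    walk₄ 106 5 6 0 6 ∷ walk₄ 51 0 4 6 3 ∷ walk₄ 10 4 0 5 4 ∷ walk₄ 95 5 3 4 5 ∷
    walk₄ 46 3 0 4 6 ∷ walk₄ 103 6 2 4 2 ∷ walk₄ 11 5 0 4 5 ∷ walk₄ 38 4 5 0 3 ∷
    walk₄ 62 2 3 2 6 ∷ walk₄ 43 2 3 5 3 ∷ walk₄ 47 5 4 5 6 ∷ walk₄ 46 0 4 0 3 ∷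
    []

cube-decomposition : ∀ r → Decomposition 4 (4 + r)
cube-decomposition 0 = D₄
cube-decomposition 1 = D₅
cube-decomposition 2 = D₆
cube-decomposition 3 = D₇
cube-decomposition (suc (suc (suc (suc r)))) = product D₄ (cube-decomposition r)

theorem2 : ∀ (n : ℕ) → 4 ≤ n → PathDivides 4 n
theorem2 (suc (suc (suc (suc r)))) (s≤s (s≤s (s≤s (s≤s _)))) = toPathDivides (cube-decomposition r)
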